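{- Let $(G,k)$ be an instance of PITVD, let $x$ be a cut vertex of $G$ and let $C$ be a pendant tree attached to $x$. Suppose some vertex of $C$ has degree at least $3$ in $G$, let $H_C=\{u\in C: d_G(u)\ge 3\}$, and let $v\in H_C$ be the vertex of $H_C$ at smallest distance from $x$. Let $D$ be a vertex set consisting of the vertices of the unique path $P_{x,v}$ between $x$ and $v$ in $G[C\cup\{x\}]$ together with two arbitrary neighbors of $v$ in $C$ not on $P_{x,v}$. Then $(G,k)$ is a yes-instance of PITVD if and only if $(G-(C\setminus D),k)$ is a yes-instance of PITVD.
   Context: PITVD: given an undirected (multi)graph $G$ without self-loops and an integer $k$, decide whether there is $X\subseteq V(G)$, $|X|\le k$, such that $G-X$ is a simple graph every connected component of which is a proper interval graph or a tree. For a cut vertex $x$ of $G$ and a connected component $C$ of $G-x$ that is a tree, $C$ is a \emph{pendant tree attached to $x$} if $G[C\cup\{x\}]$ is a tree. -}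

module Defs where

open import Data.Nat using (ℕ; zero; suc; _≤_; _<_)
open import Data.Fin using (Fin)
open import Data.Fin.Subset as Sub using (Subset; ∣_∣)
open import Data.List using (List; []; _∷_; length; map; allFin)
open import Data.Nat.ListAction using (sum)
open import Data.List.Relation.Unary.All using (All)
open import Data.List.Relation.Unary.Unique.Propositional using (Unique)
open import Data.Product using (Σ; _×_; _,_)
open import Data.Sum using (_⊎_)
open import Data.Unit using (⊤)
open import Data.Empty using (⊥)
open import Data.Rational as ℚ using (ℚ)
open import Relation.Nullary using (¬_)
open import Relation.Binary.PropositionalEquality using (_≡_; _≢_)
open import Function.Bundles using (_⇔_)

record MGraph (n : ℕ) : Set where
  field
    E        : Fin n → Fin n → ℕ
    E-sym    : ∀ u v → E u v ≡ E v u
    loopless : ∀ v → E v v ≡ 0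
open MGraph public

VSet : ℕ → Set₁
VSet n = Fin n → Set

Full : ∀ {n} → VSet n
Full _ = ⊤

module _ {n : ℕ} (G : MGraph n) where

  Adj : Fin n → Fin n → Set
  Adj u v = 1 ≤ E G u v

  deg : Fin n → ℕ
  deg u = sum (map (E G u) (allFin n))

  Simple : VSet n → Set
  Simple S = ∀ u v → S u → S v → E G u v ≤ 1

  data WalkLen (S : VSet n) (u : Fin n) : Fin n → ℕ → Set where
    here : S u → WalkLen S u u 0
    step : ∀ {v w d} → WalkLen S u v d → S w → Adj v w → WalkLen S u w (suc d)

  Reach : VSet n → Fin n → Fin n → Set
  Reach S u v = Σ ℕ (WalkLen S u v)

  IsDist : VSet n → Fin n → Fin n → ℕ → Set
  IsDist S u v d = WalkLen S u v d × (∀ d' → WalkLen S u v d' → d ≤ d')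

  Connected : VSet n → Set
  Connected S = ∀ u v → S u → S v → Reach S u v

  Chain : List (Fin n) → Set
  Chain [] = ⊤
  Chain (a ∷ []) = ⊤
  Chain (a ∷ b ∷ l) = Adj a b × Chain (b ∷ l)

  lastOf : Fin n → List (Fin n) → Fin n
  lastOf a [] = a
  lastOf a (b ∷ l) = lastOf b l

  IsPath : VSet n → Fin n → Fin n → List (Fin n) → Set
  IsPath S u v [] = ⊥
  IsPath S u v (a ∷ l) = a ≡ u × lastOf a l ≡ v × Unique (a ∷ l) × All S (a ∷ l) × Chain (a ∷ l)

  IsCycle : VSet n → Fin n → List (Fin n) → Set
  IsCycle S a l = 2 ≤ length l × Unique (a ∷ l) × All S (a ∷ l) × Chain (a ∷ l) × Adj (lastOf a l) a

  IsTree : VSet n → Set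
  IsTree S = Connected S × Simple S × (∀ a l → ¬ IsCycle S a l)

  -- G[S] is a proper interval graph: intersection graph of closed intervals
  -- [l u, r u] none of which properly contains another
  IsPIG : VSet n → Set
  IsPIG S = Σ (Fin n → ℚ) λ l → Σ (Fin n → ℚ) λ r →
      (∀ u → S u → l u ℚ.≤ r u)
    × (∀ u w → S u → S w → u ≢ w → (Adj u w ⇔ (l u ℚ.≤ r w × l w ℚ.≤ r u)))
    × (∀ u w → S u → S w → l u ℚ.≤ l w → r w ℚ.≤ r u → (l u ≡ l w × r u ≡ r w))

  Comp : VSet n → Fin n → VSet n
  Comp S v u = Reach S v u

  PITVD : VSet n → ℕ → Set
  PITVD S k = Σ (Subset n) λ X →
      (∀ u → u Sub.∈ X → S u)
    × ∣ X ∣ ≤ k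
    × Simple (λ u → S u × u Sub.∉ X)
    × (∀ v → S v → v Sub.∉ X →
         IsPIG (Comp (λ u → S u × u Sub.∉ X) v) ⊎ IsTree (Comp (λ u → S u × u Sub.∉ X) v))

  CutVertex : Fin n → Set
  CutVertex x = Σ (Fin n) λ u → Σ (Fin n) λ w →
    u ≢ x × w ≢ x × Reach Full u w × ¬ Reach (λ z → z ≢ x) u w

  IsComponentMinus : Fin n → Subset n → Set
  IsComponentMinus x C =
      Σ (Fin n) (λ c → c Sub.∈ C)
    × x Sub.∉ C
    × Connected (λ u → u Sub.∈ C)
    × (∀ u w → u Sub.∈ C → w ≢ x → Adj u w → w Sub.∈ C)

  PendantTree : Fin n → Subset n → Set
  PendantTree x C = IsComponentMinus x C × IsTree (λ u → u Sub.∈ C) × IsTree (λ u → u Sub.∈ C ⊎ u ≡ x)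

{-# OPTIONS --safe #-}
module Submission where

-- Let T = C ∪ {x}. Every vertex of P before v has no neighbours in T besides its path
-- neighbours: for x, a second neighbour in the connected set C would close a cycle; for an inner
-- vertex, a third neighbour would give it degree ≥ 3 at distance less than that of v, because a
-- potential argument shows that walks from x reach v only after running along P. Hence C ∖ P
-- meets the rest of G only at v.
--
-- Deleting vertices preserves solutions, which gives one direction. Conversely, let X′ solve the
-- reduced instance. If X′ contains v, or contains a or b (exchange it for v), then C ∖ P falls
-- apart into trees and we obtain a solution for G. Otherwise, if v keeps a neighbour w outside
-- C ∖ P and X′, then v, a, b, w form a claw, so every component through v is a tree; collapsing
-- the deleted vertices onto v maps G − X′ into the reduced graph, and as every cycle of G lies in
-- T or avoids C, putting them back creates no cycle. If v keeps no such neighbour, v together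
-- with C ∖ P is a union of components of G − X′ inside T.

open import Defs
open import Data.Nat using (ℕ; zero; suc; _+_; _⊓_; _≤_; _<_; z≤n; s≤s)
open import Data.Nat.Properties
open import Data.Nat.Induction using (<-rec)
open import Data.Nat.ListAction using (sum)
open import Data.Nat.ListAction.Properties using (sum-↭)
open import Data.Fin using (Fin; toℕ; fromℕ<)
open import Data.Fin.Properties using (any?; toℕ<n; toℕ-fromℕ<) renaming (_≟_ to _≟ᶠ_)
open import Data.Fin.Subset as Sub using (Subset; inside; outside; ∣_∣)
open import Data.Fin.Subset.Properties
  using (_∈?_; ∣⁅x⁆∣≡1; x∈p⇒∣p-x∣<∣p∣; ∣p∩q∣≤∣p∣; x∈p∩q⁺; x∈p∩q⁻; x∈∁p⇒x∉p; x∉p⇒x∈∁p; x∈p∪q⁺; x∈⁅x⁆; x∈p∧x≢y⇒x∈p-y)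
import Data.Rational as ℚ
import Data.Rational.Properties as ℚP
open import Data.Vec using ([]; _∷_)
open import Data.List using (List; []; _∷_; [_]; length; map; _++_)
open import Data.List.Membership.Propositional as L using (_∈_)
open import Data.List.Membership.Propositional.Properties using (∈-∃++; ∈-allFin; ∈-++⁺ʳ)
open import Data.List.Relation.Unary.Any as Any using (here; there)
open import Data.List.Relation.Unary.All as All using (All; []; _∷_)
open import Data.List.Relation.Unary.All.Properties using (¬Any⇒All¬; ++⁺)
open import Data.List.Relation.Unary.AllPairs using ([]; _∷_)
open import Data.List.Relation.Unary.Unique.Propositional using (Unique)
open import Data.List.Relation.Binary.Permutation.Propositional using (↭-sym)
open import Data.List.Relation.Binary.Permutation.Propositional.Properties using (shift; map⁺; ∈-resp-↭)
open import Data.Product using (∃; ∃-syntax; _×_; _,_; proj₁; proj₂)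
open import Data.Sum using (_⊎_; inj₁; inj₂)
open import Data.Unit using (tt)
open import Data.Empty using (⊥; ⊥-elim)
open import Function using (_∘_)
open import Function.Bundles using (_⇔_; mk⇔; Equivalence)
open import Relation.Nullary using (¬_; Dec; yes; no)
open import Relation.Nullary.Decidable using (_×-dec_; _⊎-dec_; ¬?; decidable-stable)
open import Relation.Unary using (_⊆_; _∩_; Decidable)
open import Relation.Binary.Definitions using (DecidableEquality)
open import Relation.Binary.PropositionalEquality
  using (_≡_; _≢_; ≢-sym; refl; sym; trans; cong; subst; module ≡-Reasoning)

length≤sum-map : ∀ {A : Set} (f : A → ℕ) {ys xs : List A} → Unique ys → (∀ {y} → y ∈ ys → y ∈ xs) →
  All (λ y → 1 ≤ f y) ys → length ys ≤ sum (map f xs)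
length≤sum-map f [] _ [] = z≤n
length≤sum-map f {y ∷ ys} (y∉ys ∷ ys-unique) ys⊆xs (1≤fy ∷ 1≤fys)
  with ws , zs , refl ← ∈-∃++ (ys⊆xs (here refl)) = begin
    suc (length ys)                  ≤⟨ +-mono-≤ 1≤fy (length≤sum-map f ys-unique ys⊆ws++zs 1≤fys) ⟩
    f y + sum (map f (ws ++ zs))     ≡⟨ sum-↭ (map⁺ f (↭-sym (shift y ws zs))) ⟩
    sum (map f (ws ++ [ y ] ++ zs))  ∎
  where
  open ≤-Reasoning
  ys⊆ws++zs : ∀ {u} → u ∈ ys → u ∈ ws ++ zs
  ys⊆ws++zs u∈ys with ∈-resp-↭ (shift y ws zs) (ys⊆xs (there u∈ys))
  ... | here u≡y = ⊥-elim (All.lookup y∉ys u∈ys (sym u≡y))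
  ... | there u∈ws++zs = u∈ws++zs

least-witness : {Q : ℕ → Set} → (∀ d → Dec (Q d)) → ∀ {L} → Q L → ∃[ d ] Q d × (∀ d′ → Q d′ → d ≤ d′)
least-witness {Q} Q? {L} = <-rec (λ L → Q L → ∃[ d ] Q d × (∀ d′ → Q d′ → d ≤ d′)) descend L
  where
  descend : ∀ L → (∀ {d} → d < L → Q d → ∃[ d ] Q d × (∀ d′ → Q d′ → d ≤ d′)) →
    Q L → ∃[ d ] Q d × (∀ d′ → Q d′ → d ≤ d′)
  descend L shorter qL with any? (λ (i : Fin L) → Q? (toℕ i))
  ... | yes (i , qi) = shorter (toℕ<n i) qi
  ... | no none = L , qL , λ d′ qd′ → ≮⇒≥ λ d′<L →
    none (fromℕ< d′<L , subst Q (sym (toℕ-fromℕ< d′<L)) qd′)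

Unique-middle : ∀ {A : Set} {x : A} ys {zs} → Unique (ys ++ x ∷ zs) → All (x ≢_) ys × All (x ≢_) zs
Unique-middle [] (x∉zs ∷ _) = [] , x∉zs
Unique-middle {x = x} (y ∷ ys) (y∉ ∷ unique) with Unique-middle ys unique
... | x∉ys , x∉zs = ≢-sym (All.lookup y∉ (∈-++⁺ʳ ys (here refl))) ∷ x∉ys , x∉zs

∣p∪q∣≤∣p∣+∣q∣ : ∀ {m} (p q : Subset m) → ∣ p Sub.∪ q ∣ ≤ ∣ p ∣ + ∣ q ∣
∣p∪q∣≤∣p∣+∣q∣ [] [] = z≤n
∣p∪q∣≤∣p∣+∣q∣ (inside ∷ p) (inside ∷ q) =
  s≤s (≤-trans (∣p∪q∣≤∣p∣+∣q∣ p q) (+-monoʳ-≤ ∣ p ∣ (n≤1+n ∣ q ∣)))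
∣p∪q∣≤∣p∣+∣q∣ (inside ∷ p) (outside ∷ q) = s≤s (∣p∪q∣≤∣p∣+∣q∣ p q)
∣p∪q∣≤∣p∣+∣q∣ (outside ∷ p) (inside ∷ q) = ≤-trans (s≤s (∣p∪q∣≤∣p∣+∣q∣ p q)) (≤-reflexive (sym (+-suc ∣ p ∣ ∣ q ∣)))
∣p∪q∣≤∣p∣+∣q∣ (outside ∷ p) (outside ∷ q) = ∣p∪q∣≤∣p∣+∣q∣ p q

∣p-x∪⁅y⁆∣≤∣p∣ : ∀ {m} {p : Subset m} {x} y → x Sub.∈ p → ∣ (p Sub.- x) Sub.∪ Sub.⁅ y ⁆ ∣ ≤ ∣ p ∣
∣p-x∪⁅y⁆∣≤∣p∣ {p = p} {x} y x∈p = begin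
  ∣ (p Sub.- x) Sub.∪ Sub.⁅ y ⁆ ∣  ≤⟨ ∣p∪q∣≤∣p∣+∣q∣ (p Sub.- x) Sub.⁅ y ⁆ ⟩
  ∣ p Sub.- x ∣ + ∣ Sub.⁅ y ⁆ ∣    ≡⟨ cong (∣ p Sub.- x ∣ +_) (∣⁅x⁆∣≡1 y) ⟩
  ∣ p Sub.- x ∣ + 1                ≡⟨ +-comm ∣ p Sub.- x ∣ 1 ⟩
  suc ∣ p Sub.- x ∣                ≤⟨ x∈p⇒∣p-x∣<∣p∣ x∈p ⟩
  ∣ p ∣                            ∎
  where open ≤-Reasoning

_∖_ : ∀ {n} → VSet n → Subset n → VSet n
S ∖ X = λ u → S u × u Sub.∉ X

-- nth d l i is d when i is out of range, and position u l is length l when u ∉ l.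
module Positions {A : Set} (_≟_ : DecidableEquality A) where

  nth : A → List A → ℕ → A
  nth d [] i = d
  nth d (a ∷ l) zero = a
  nth d (a ∷ l) (suc i) = nth d l i

  position : A → List A → ℕ
  position u [] = 0
  position u (a ∷ l) with a ≟ u
  ... | yes _ = 0
  ... | no _ = suc (position u l)

  nth-∈ : ∀ d l {i} → i < length l → nth d l i ∈ l
  nth-∈ d (a ∷ l) {zero} _ = here refl
  nth-∈ d (a ∷ l) {suc i} (s≤s i<l) = there (nth-∈ d l i<l)

  nth-All : ∀ {P : A → Set} d {l i} → All P l → i < length l → P (nth d l i)
  nth-All d {a ∷ l} {zero} (pa ∷ _) _ = pa
  nth-All d {a ∷ l} {suc i} (_ ∷ pl) (s≤s i<l) = nth-All d pl i<l

  position<length : ∀ {u l} → u ∈ l → position u l < length l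
  position<length {u} {a ∷ l} u∈l with a ≟ u
  ... | yes _ = s≤s z≤n
  position<length {u} {a ∷ l} (here u≡a) | no a≢u = ⊥-elim (a≢u (sym u≡a))
  position<length {u} {a ∷ l} (there u∈l) | no _ = s≤s (position<length u∈l)

  nth-position : ∀ d {u} l → position u l < length l → nth d l (position u l) ≡ u
  nth-position d {u} (a ∷ l) lt with a ≟ u
  ... | yes a≡u = a≡u
  ... | no _ = nth-position d l (≤-pred lt)

  position-nth : ∀ d {l i} → Unique l → i < length l → position (nth d l i) l ≡ i
  position-nth d {a ∷ l} {zero} _ _ with a ≟ a
  ... | yes _ = refl
  ... | no a≢a = ⊥-elim (a≢a refl)
  position-nth d {a ∷ l} {suc i} (a∉l ∷ l-unique) (s≤s i<l) with a ≟ nth d l i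
  ... | yes a≡ = ⊥-elim (All.lookup a∉l (nth-∈ d l i<l) a≡)
  ... | no _ = cong suc (position-nth d l-unique i<l)

module Graph {n : ℕ} (G : MGraph n) where

  Adj-sym : ∀ {u w} → Adj G u w → Adj G w u
  Adj-sym {u} {w} = subst (1 ≤_) (E-sym G u w)

  Adj⇒≢ : ∀ {u w} → Adj G u w → u ≢ w
  Adj⇒≢ {u} adj refl = n≮0 (subst (1 ≤_) (loopless G u) adj)

  Adj? : ∀ u w → Dec (Adj G u w)
  Adj? u w = 1 ≤? E G u w

  WalkLen-end : ∀ {S u w d} → WalkLen G S u w d → S w
  WalkLen-end (here s) = s
  WalkLen-end (step _ s _) = s

  WalkLen-mono : ∀ {S S′} → S ⊆ S′ → ∀ {u w d} → WalkLen G S u w d → WalkLen G S′ u w d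
  WalkLen-mono S⊆S′ (here s) = here (S⊆S′ s)
  WalkLen-mono S⊆S′ (step W s adj) = step (WalkLen-mono S⊆S′ W) (S⊆S′ s) adj

  WalkLen-restrict : ∀ {S Q : VSet n} → (∀ {u w} → S u → S w → Adj G u w → Q u → Q w) →
    ∀ {s t d} → WalkLen G S s t d → Q s → WalkLen G (S ∩ Q) s t d
  WalkLen-restrict Q-closed (here s) q = here (s , q)
  WalkLen-restrict Q-closed (step W s adj) q with WalkLen-restrict Q-closed W q
  ... | W′ = step W′ (s , Q-closed (proj₁ (WalkLen-end W′)) s adj (proj₂ (WalkLen-end W′))) adj

  WalkLen-cons : ∀ {S u v w d} → S u → Adj G u v → WalkLen G S v w d → WalkLen G S u w (suc d)
  WalkLen-cons su adj (here sv) = step (here su) sv adj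
  WalkLen-cons su adj (step W s adj′) = step (WalkLen-cons su adj W) s adj′

  WalkLen-reverse : ∀ {S u w d} → WalkLen G S u w d → WalkLen G S w u d
  WalkLen-reverse (here s) = here s
  WalkLen-reverse (step W s adj) = WalkLen-cons s (Adj-sym adj) (WalkLen-reverse W)

  Reach-sym : ∀ {S u w} → Reach G S u w → Reach G S w u
  Reach-sym (d , W) = d , WalkLen-reverse W

  Reach-trans : ∀ {S u v w} → Reach G S u v → Reach G S v w → Reach G S u w
  Reach-trans r (_ , here _) = r
  Reach-trans r (_ , step W s adj) with Reach-trans r (_ , W)
  ... | d , W′ = suc d , step W′ s adj

  WalkLen-potential : (h : Fin n → ℕ) → (∀ {u w} → Adj G u w → h w ≤ suc (h u)) →
    ∀ {S s t d} → WalkLen G S s t d → h t ≤ h s + d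
  WalkLen-potential h h-lipschitz {s = s} (here _) = m≤m+n (h s) 0
  WalkLen-potential h h-lipschitz {s = s} {t} {suc d} (step W _ adj) = begin
    h t           ≤⟨ h-lipschitz adj ⟩
    suc (h _)     ≤⟨ s≤s (WalkLen-potential h h-lipschitz W) ⟩
    suc (h s + d) ≡⟨ +-suc (h s) d ⟨
    h s + suc d   ∎
    where open ≤-Reasoning

  WalkLen? : ∀ s d t → Dec (WalkLen G Full s t d)
  WalkLen? s zero t with s ≟ᶠ t
  ... | yes refl = yes (here tt)
  ... | no s≢t = no λ { (here _) → s≢t refl }
  WalkLen? s (suc d) t with any? (λ u → WalkLen? s d u ×-dec Adj? u t)
  ... | yes (u , W , adj) = yes (step W tt adj)
  ... | no none = no λ { (step W _ adj) → none (_ , W , adj) }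

  distance : ∀ {s t d} → WalkLen G Full s t d → ∃ (IsDist G Full s t)
  distance {s} {t} = least-witness (λ d → WalkLen? s d t)

  open Positions (_≟ᶠ_ {n})

  Chain-nth : ∀ d l {i} → Chain G l → suc i < length l → Adj G (nth d l i) (nth d l (suc i))
  Chain-nth d (a ∷ []) _ (s≤s ())
  Chain-nth d (a ∷ b ∷ l) {zero} (adj , _) _ = adj
  Chain-nth d (a ∷ b ∷ l) {suc i} (_ , chain) (s≤s i<l) = Chain-nth d (b ∷ l) chain i<l

  nth-last : ∀ d a l → nth d (a ∷ l) (length l) ≡ lastOf G a l
  nth-last d a [] = refl
  nth-last d a (b ∷ l) = nth-last d b l

  lastOf-∈ : ∀ a l → lastOf G a l ∈ a ∷ l
  lastOf-∈ a [] = here refl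
  lastOf-∈ a (b ∷ l) = there (lastOf-∈ b l)

  Chain-++⁻ : ∀ us {ws} → Chain G (us ++ ws) → Chain G us × Chain G ws
  Chain-++⁻ [] chain = tt , chain
  Chain-++⁻ (u ∷ []) {[]} _ = tt , tt
  Chain-++⁻ (u ∷ []) {w ∷ ws} (_ , chain) = tt , chain
  Chain-++⁻ (u ∷ u′ ∷ us) (adj , chain) with Chain-++⁻ (u′ ∷ us) chain
  ... | chain₁ , chain₂ = (adj , chain₁) , chain₂

  lastOf-++ : ∀ a ys w zs → lastOf G a (ys ++ w ∷ zs) ≡ lastOf G w zs
  lastOf-++ a [] w zs = refl
  lastOf-++ a (b ∷ ys) w zs = lastOf-++ b ys w zs

  IsPath-suffix : ∀ {S u v w} p → IsPath G S u v p → w ∈ p → ∃ (IsPath G S w v)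
  IsPath-suffix (a ∷ l) (_ , last≡v , unique , inS , chain) (here w≡a) =
    a ∷ l , sym w≡a , last≡v , unique , inS , chain
  IsPath-suffix (a ∷ b ∷ l) (_ , last≡v , _ ∷ unique , _ ∷ inS , (_ , chain)) (there w∈l) =
    IsPath-suffix (b ∷ l) (refl , last≡v , unique , inS , chain) w∈l

  WalkLen⇒IsPath : ∀ {S u w d} → WalkLen G S u w d → ∃ (IsPath G S w u)
  WalkLen⇒IsPath (here s) = _ ∷ [] , refl , refl , [] ∷ [] , s ∷ [] , tt
  WalkLen⇒IsPath (step {w = w} W s adj) with WalkLen⇒IsPath W
  ... | p , path with Any.any? (w ≟ᶠ_) p
  ...   | yes w∈p = IsPath-suffix p path w∈p
  WalkLen⇒IsPath (step {w = w} W s adj) | b ∷ l , (b≡ , last≡ , unique , inS , chain) | no w∉p =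
    w ∷ b ∷ l , refl , last≡ , ¬Any⇒All¬ (b ∷ l) w∉p ∷ unique , s ∷ inS ,
    (subst (Adj G w) (sym b≡) (Adj-sym adj) , chain)

  Comp-step : ∀ {S v u w} → Comp G S v u → S w → Adj G u w → Comp G S v w
  Comp-step (d , W) s adj = suc d , step W s adj

  Comp-⊆ : ∀ {S v} → Comp G S v ⊆ S
  Comp-⊆ (_ , W) = WalkLen-end W

  Comp-mono : ∀ {S S′ v} → S ⊆ S′ → Comp G S v ⊆ Comp G S′ v
  Comp-mono S⊆S′ (d , W) = d , WalkLen-mono S⊆S′ W

  Comp-restrict : ∀ {S Q : VSet n} {v} → (∀ {u w} → S u → S w → Adj G u w → Q u → Q w) →
    Q v → Comp G S v ⊆ Comp G (S ∩ Q) v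
  Comp-restrict Q-closed qv (d , W) = d , WalkLen-restrict Q-closed W qv

  Comp-⊆-closed : ∀ {S Q : VSet n} {v} → (∀ {u w} → S u → S w → Adj G u w → Q u → Q w) →
    Q v → Comp G S v ⊆ Q
  Comp-⊆-closed Q-closed qv r = proj₂ (Comp-⊆ (Comp-restrict Q-closed qv r))

  Comp-connected : ∀ {S v} → Connected G (Comp G S v)
  Comp-connected u w r₁ r₂ with Reach-trans (Reach-sym r₁) r₂
  ... | d , W = d , WalkLen-mono proj₂ (WalkLen-restrict (λ _ s adj r → Comp-step r s adj) W r₁)

  Comp-map : ∀ {A B : VSet n} (f : Fin n → Fin n) → (∀ {u} → A u → B (f u)) →
    (∀ {u w} → A u → A w → Adj G u w → f u ≡ f w ⊎ Adj G (f u) (f w)) →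
    ∀ {v u} → Comp G A v u → Comp G B (f v) (f u)
  Comp-map f f-into f-edge (_ , here a) = 0 , here (f-into a)
  Comp-map f f-into f-edge (_ , step W a adj) with Comp-map f f-into f-edge (_ , W)
  ... | r with f-edge (WalkLen-end W) a adj
  ...   | inj₁ f≡ = subst (Comp G _ _) f≡ r
  ...   | inj₂ f-adj = Comp-step r (f-into a) f-adj

  Forest : VSet n → Set
  Forest S = Simple G S × (∀ a l → ¬ IsCycle G S a l)

  IsCycle-on : ∀ {S S′ a l} → All S′ (a ∷ l) → IsCycle G S a l → IsCycle G S′ a l
  IsCycle-on onS′ (long , unique , _ , chain , closed) = long , unique , onS′ , chain , closed

  IsTree-⊆ : ∀ {K K′} → Connected G K → K ⊆ K′ → Forest K′ → IsTree G K
  IsTree-⊆ connected K⊆K′ (simple , acyclic) =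
    connected , (λ u w ku kw → simple u w (K⊆K′ ku) (K⊆K′ kw)) ,
    λ { a l cycle@(_ , _ , inK , _) → acyclic a l (IsCycle-on (All.map K⊆K′ inK) cycle) }

  IsPIG-⊆ : ∀ {K K′} → K ⊆ K′ → IsPIG G K′ → IsPIG G K
  IsPIG-⊆ K⊆K′ (l , r , l≤r , adj⇔ , proper) =
    l , r , (λ u ku → l≤r u (K⊆K′ ku)) ,
    (λ u w ku kw → adj⇔ u w (K⊆K′ ku) (K⊆K′ kw)) ,
    (λ u w ku kw → proper u w (K⊆K′ ku) (K⊆K′ kw))

  Simple-cover : ∀ {A B W : VSet n} → Simple G A → Simple G B →
    (∀ {u w} → W u → W w → Adj G u w → (A u × A w) ⊎ (B u × B w)) → Simple G W
  Simple-cover simpleA simpleB cover u w wu ww with Adj? u w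
  ... | no ¬adj = <⇒≤ (≰⇒> ¬adj)
  ... | yes adj with cover wu ww adj
  ...   | inj₁ (au , aw) = simpleA u w au aw
  ...   | inj₂ (bu , bw) = simpleB u w bu bw

  three-neighbours⇒3≤deg : ∀ {u p q r} → p ≢ q → p ≢ r → q ≢ r →
    Adj G u p → Adj G u q → Adj G u r → 3 ≤ deg G u
  three-neighbours⇒3≤deg {u} p≢q p≢r q≢r up uq ur =
    length≤sum-map (E G u) ((p≢q ∷ p≢r ∷ []) ∷ (q≢r ∷ []) ∷ [] ∷ [])
      (λ _ → ∈-allFin _) (up ∷ uq ∷ ur ∷ [])

  Claw : Fin n → Fin n → Fin n → Fin n → Set
  Claw c a b w = (Adj G c a × Adj G c b × Adj G c w) × (Independent a b × Independent a w × Independent b w)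
    where
    Independent : Fin n → Fin n → Set
    Independent u w = u ≢ w × ¬ Adj G u w

  IsPIG-claw-free : ∀ {K c a b w} → IsPIG G K → K c → K a → K b → K w → ¬ Claw c a b w
  IsPIG-claw-free {K} {c} {a} {b} {w} (l , r , l≤r , adj⇔ , proper) kc ka kb kw
    ((ca , cb , cw) , (a≢b , ¬ab) , (a≢w , ¬aw) , (b≢w , ¬bw)) =
    orient (separated ka kb a≢b ¬ab) (separated ka kw a≢w ¬aw) (separated kb kw b≢w ¬bw)
    where
    _≺_ : Fin n → Fin n → Set
    i ≺ j = r i ℚ.< l j

    Leaf : Fin n → Set
    Leaf i = K i × Adj G c i

    separated : ∀ {i j} → K i → K j → i ≢ j → ¬ Adj G i j → i ≺ j ⊎ j ≺ i
    separated {i} {j} ki kj i≢j ¬ij with l i ℚ.≤? r j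
    ... | yes li≤rj = inj₁ (ℚP.≰⇒> λ lj≤ri → ¬ij (Equivalence.from (adj⇔ i j ki kj i≢j) (li≤rj , lj≤ri)))
    ... | no li≰rj = inj₂ (ℚP.≰⇒> li≰rj)

    ≺-trans : ∀ {i j k} → K j → i ≺ j → j ≺ k → i ≺ k
    ≺-trans {j = j} kj i≺j j≺k = ℚP.<-trans (ℚP.<-≤-trans i≺j (l≤r j kj)) j≺k

    no-cycle : ∀ {i j k} → K i → K j → K k → i ≺ j → j ≺ k → k ≺ i → ⊥
    no-cycle {i} ki kj kk i≺j j≺k k≺i =
      ℚP.<-irrefl refl (ℚP.<-≤-trans (≺-trans kk (≺-trans kj i≺j j≺k) k≺i) (l≤r i ki))

    -- The interval of c meets those of i and j, so it contains the one of m lying between them.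
    no-middle : ∀ {i m j} → Leaf i → Leaf m → Leaf j → i ≺ m → m ≺ j → ⊥
    no-middle {i} {m} {j} (ki , ci) (km , cm) (kj , cj) i≺m m≺j =
      ℚP.<-irrefl (proj₁ (proper c m kc km (ℚP.<⇒≤ lc<lm) rm≤rc)) lc<lm
      where
      meets : ∀ {u} → Leaf u → l c ℚ.≤ r u × l u ℚ.≤ r c
      meets {u} (ku , cu) = Equivalence.to (adj⇔ c u kc ku (Adj⇒≢ cu)) cu
      lc<lm = ℚP.≤-<-trans (proj₁ (meets (ki , ci))) i≺m
      rm≤rc = ℚP.<⇒≤ (ℚP.<-≤-trans m≺j (proj₂ (meets (kj , cj))))

    A = ka , ca
    B = kb , cb
    W = kw , cw

    orient : a ≺ b ⊎ b ≺ a → a ≺ w ⊎ w ≺ a → b ≺ w ⊎ w ≺ b → ⊥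
    orient (inj₁ a≺b) (inj₁ a≺w) (inj₁ b≺w) = no-middle A B W a≺b b≺w
    orient (inj₁ a≺b) (inj₁ a≺w) (inj₂ w≺b) = no-middle A W B a≺w w≺b
    orient (inj₁ a≺b) (inj₂ w≺a) (inj₁ b≺w) = no-cycle ka kb kw a≺b b≺w w≺a
    orient (inj₁ a≺b) (inj₂ w≺a) (inj₂ w≺b) = no-middle W A B w≺a a≺b
    orient (inj₂ b≺a) (inj₁ a≺w) (inj₁ b≺w) = no-middle B A W b≺a a≺w
    orient (inj₂ b≺a) (inj₁ a≺w) (inj₂ w≺b) = no-cycle kb ka kw b≺a a≺w w≺b
    orient (inj₂ b≺a) (inj₂ w≺a) (inj₁ b≺w) = no-middle B W A b≺w w≺a
    orient (inj₂ b≺a) (inj₂ w≺a) (inj₂ w≺b) = no-middle W B A w≺b b≺a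

  IsPIGorTree : VSet n → Set
  IsPIGorTree K = IsPIG G K ⊎ IsTree G K

  IsPIGorTree-⊆ : ∀ {K K′} → Connected G K → K ⊆ K′ → IsPIGorTree K′ → IsPIGorTree K
  IsPIGorTree-⊆ _ K⊆K′ (inj₁ pig) = inj₁ (IsPIG-⊆ K⊆K′ pig)
  IsPIGorTree-⊆ connected K⊆K′ (inj₂ (_ , forest)) = inj₂ (IsTree-⊆ connected K⊆K′ forest)

  IsDeletionSet : VSet n → Subset n → Set
  IsDeletionSet S X = Simple G (S ∖ X) × (∀ v → S v → v Sub.∉ X → IsPIGorTree (Comp G (S ∖ X) v))

  IsDeletionSet-antitone : ∀ {S X S′ X′} → S′ ∖ X′ ⊆ S ∖ X → IsDeletionSet S X → IsDeletionSet S′ X′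
  IsDeletionSet-antitone sub (simple , comps) =
    (λ u w su sw → simple u w (sub su) (sub sw)) ,
    λ v sv v∉X′ → let (sv′ , v∉X) = sub (sv , v∉X′) in
      IsPIGorTree-⊆ Comp-connected (Comp-mono sub) (comps v sv′ v∉X)

  IsDeletionSet-glue : ∀ {S X′ X T} (Z : VSet n) → Decidable Z → Forest T → Z ⊆ T →
    (∀ {u w} → u Sub.∉ X → w Sub.∉ X → Adj G u w → Z u → Z w) →
    (∀ {u} → u Sub.∉ X → ¬ Z u → (S ∖ X′) u) →
    IsDeletionSet S X′ → IsDeletionSet Full X
  IsDeletionSet-glue {S} {X′} {X} {T} Z Z? T-forest Z⊆T Z-closed covered (simple , comps) =
    Simple-cover (proj₁ T-forest) simple cover , comps′
    where
    Z-closed′ : ∀ {u w} → (Full ∖ X) u → (Full ∖ X) w → Adj G u w → Z u → Z w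
    Z-closed′ (_ , u∉X) (_ , w∉X) = Z-closed u∉X w∉X
    ¬Z-closed : ∀ {u w} → (Full ∖ X) u → (Full ∖ X) w → Adj G u w → ¬ Z u → ¬ Z w
    ¬Z-closed fu fw adj ¬zu zw = ¬zu (Z-closed′ fw fu (Adj-sym adj) zw)
    cover : ∀ {u w} → (Full ∖ X) u → (Full ∖ X) w → Adj G u w → (T u × T w) ⊎ ((S ∖ X′) u × (S ∖ X′) w)
    cover {u} fu fw adj with Z? u
    ... | yes zu = inj₁ (Z⊆T zu , Z⊆T (Z-closed′ fu fw adj zu))
    ... | no ¬zu = inj₂ (covered (proj₂ fu) ¬zu , covered (proj₂ fw) (¬Z-closed fu fw adj ¬zu))
    comps′ : ∀ v → Full v → v Sub.∉ X → IsPIGorTree (Comp G (Full ∖ X) v)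
    comps′ v _ v∉X with Z? v
    ... | yes zv = inj₂ (IsTree-⊆ Comp-connected (λ r → Z⊆T (Comp-⊆-closed Z-closed′ zv r)) T-forest)
    ... | no ¬zv = IsPIGorTree-⊆ Comp-connected
      (λ r → Comp-mono (λ { (fu , ¬zu) → covered (proj₂ fu) ¬zu }) (Comp-restrict ¬Z-closed ¬zv r))
      (comps v (proj₁ (covered v∉X ¬zv)) (proj₂ (covered v∉X ¬zv)))

  PITVD-complement : ∀ {S′ : VSet n} {k} (R : Subset n) →
    (∀ {u} → S′ u → u Sub.∉ R) → (∀ {u} → u Sub.∉ R → S′ u) → PITVD G Full k → PITVD G S′ k
  PITVD-complement R S′⇒∉R ∉R⇒S′ (X , _ , size , deletion) =
    X Sub.∩ Sub.∁ R ,
    (λ u u∈X′ → ∉R⇒S′ (x∈∁p⇒x∉p (proj₂ (x∈p∩q⁻ X (Sub.∁ R) u∈X′)))) ,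
    ≤-trans (∣p∩q∣≤∣p∣ X (Sub.∁ R)) size ,
    IsDeletionSet-antitone (λ (s , u∉X′) → tt , λ u∈X → u∉X′ (x∈p∩q⁺ (u∈X , x∉p⇒x∈∁p (S′⇒∉R s)))) deletion

module Separator {n : ℕ} (G : MGraph n) (x : Fin n) (C : Subset n) (x∉C : x Sub.∉ C)
  (C-closed : ∀ {u w} → u Sub.∈ C → w ≢ x → Adj G u w → w Sub.∈ C) where
  open Graph G

  T : VSet n
  T u = u Sub.∈ C ⊎ u ≡ x

  Chain-uniform : ∀ c l → Chain G (c ∷ l) → All (x ≢_) (c ∷ l) →
    All (Sub._∈ C) (c ∷ l) ⊎ All (Sub._∉ C) (c ∷ l)
  Chain-uniform c [] _ _ with c ∈? C
  ... | yes c∈C = inj₁ (c∈C ∷ [])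
  ... | no c∉C = inj₂ (c∉C ∷ [])
  Chain-uniform c (d ∷ l) (cd , chain) (x≢c ∷ x≢dl) with Chain-uniform d l chain x≢dl
  ... | inj₁ (d∈C ∷ l⊆C) = inj₁ (C-closed d∈C (≢-sym x≢c) (Adj-sym cd) ∷ d∈C ∷ l⊆C)
  ... | inj₂ (d∉C ∷ l∉C) = inj₂ ((λ c∈C → d∉C (C-closed c∈C (≢-sym (All.head x≢dl)) cd)) ∷ d∉C ∷ l∉C)

  Inside-or-outside : List (Fin n) → Set
  Inside-or-outside l = All T l ⊎ All (Sub._∉ C) l

  cycle-inside-or-outside : ∀ {S a l} → IsCycle G S a l → Inside-or-outside (a ∷ l)
  cycle-inside-or-outside {a = a} {l} (_ , unique , _ , chain , closed) with Any.any? (x ≟ᶠ_) (a ∷ l)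
  ... | no x∉cycle with Chain-uniform a l chain (¬Any⇒All¬ (a ∷ l) x∉cycle)
  ...   | inj₁ inC = inj₁ (All.map inj₁ inC)
  ...   | inj₂ offC = inj₂ offC
  cycle-inside-or-outside {l = l} (_ , unique , _ , chain , closed) | yes (here refl) = from-x l unique chain
    where
    from-x : ∀ l → Unique (x ∷ l) → Chain G (x ∷ l) → Inside-or-outside (x ∷ l)
    from-x [] _ _ = inj₁ (inj₂ refl ∷ [])
    from-x (b ∷ l) (x≢bl ∷ _) (_ , chain) with Chain-uniform b l chain x≢bl
    ... | inj₁ inC = inj₁ (inj₂ refl ∷ All.map inj₁ inC)
    ... | inj₂ offC = inj₂ (x∉C ∷ offC)
  cycle-inside-or-outside {a = a} (_ , unique , _ , chain , closed) | yes (there x∈l)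
    with ys , zs , refl ← ∈-∃++ x∈l
    with Unique-middle (a ∷ ys) unique | Chain-++⁻ (a ∷ ys) chain
  ... | x≢ays , x≢zs | chain₁ , chain₂ =
    glue zs x≢zs chain₂ (subst (λ z → Adj G z a) (lastOf-++ a ys x zs) closed) (Chain-uniform a ys chain₁ x≢ays)
    where
    glue : ∀ zs → All (x ≢_) zs → Chain G (x ∷ zs) → Adj G (lastOf G x zs) a →
      All (Sub._∈ C) (a ∷ ys) ⊎ All (Sub._∉ C) (a ∷ ys) → Inside-or-outside (a ∷ ys ++ x ∷ zs)
    glue [] _ _ _ (inj₁ inC) = inj₁ (++⁺ (All.map inj₁ inC) (inj₂ refl ∷ []))
    glue [] _ _ _ (inj₂ offC) = inj₂ (++⁺ offC (x∉C ∷ []))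
    glue (b ∷ zs) x≢bzs (_ , chain) last-a side₁ with Chain-uniform b zs chain x≢bzs | side₁
    ... | inj₁ inC₂ | inj₁ inC₁ = inj₁ (++⁺ (All.map inj₁ inC₁) (inj₂ refl ∷ All.map inj₁ inC₂))
    ... | inj₂ offC₂ | inj₂ offC₁ = inj₂ (++⁺ offC₁ (x∉C ∷ offC₂))
    ... | inj₁ inC₂ | inj₂ (a∉C ∷ _) =
      ⊥-elim (a∉C (C-closed (All.lookup inC₂ (lastOf-∈ b zs)) (≢-sym (All.head x≢ays)) last-a))
    ... | inj₂ offC₂ | inj₁ (a∈C ∷ _) =
      ⊥-elim (All.lookup offC₂ (lastOf-∈ b zs)
        (C-closed a∈C (≢-sym (All.lookup x≢bzs (lastOf-∈ b zs))) (Adj-sym last-a)))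

module Pendant {n : ℕ} (G : MGraph n) (x : Fin n) (C : Subset n) (pendant : PendantTree G x C) where
  open Graph G
  open Positions (_≟ᶠ_ {n})

  x∉C : x Sub.∉ C
  x∉C = proj₁ (proj₂ (proj₁ pendant))

  C-connected : Connected G (Sub._∈ C)
  C-connected = proj₁ (proj₂ (proj₂ (proj₁ pendant)))

  C-closed : ∀ {u w} → u Sub.∈ C → w ≢ x → Adj G u w → w Sub.∈ C
  C-closed {u} {w} = proj₂ (proj₂ (proj₂ (proj₁ pendant))) u w

  open Separator G x C x∉C C-closed

  T-forest : Forest T
  T-forest = proj₂ (proj₂ (proj₂ pendant))

  T? : Decidable T
  T? u = (u ∈? C) ⊎-dec (u ≟ᶠ x)

  T⇒∈C : ∀ {u} → T u → u ≢ x → u Sub.∈ C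
  T⇒∈C (inj₁ u∈C) _ = u∈C
  T⇒∈C (inj₂ u≡x) u≢x = ⊥-elim (u≢x u≡x)

  C-neighbour-∈T : ∀ {u w} → u Sub.∈ C → Adj G u w → T w
  C-neighbour-∈T {w = w} u∈C adj with w ≟ᶠ x
  ... | yes w≡x = inj₂ w≡x
  ... | no w≢x = inj₁ (C-closed u∈C w≢x adj)

  module BranchPath (v : Fin n) (v∈C : v Sub.∈ C)
    (v-nearest : ∀ u → u Sub.∈ C → 3 ≤ deg G u → ∀ du dv →
      IsDist G Full x u du → IsDist G Full x v dv → dv ≤ du)
    (ps : List (Fin n)) (last≡v : lastOf G x ps ≡ v) (P-unique : Unique (x ∷ ps))
    (P⊆T : All T (x ∷ ps)) (P-chain : Chain G (x ∷ ps)) where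

    P : List (Fin n)
    P = x ∷ ps

    m : ℕ
    m = length ps

    at : ℕ → Fin n
    at = nth x P

    pos : Fin n → ℕ
    pos u = position u P

    at-last : at m ≡ v
    at-last = trans (nth-last x x ps) last≡v

    at-∈ : ∀ {i} → i ≤ m → at i ∈ P
    at-∈ i≤m = nth-∈ x P (s≤s i≤m)

    at-adj : ∀ {i} → i < m → Adj G (at i) (at (suc i))
    at-adj i<m = Chain-nth x P P-chain (s≤s i<m)

    pos-at : ∀ {i} → i ≤ m → pos (at i) ≡ i
    pos-at i≤m = position-nth x P-unique (s≤s i≤m)

    at-pos : ∀ {u} → pos u ≤ m → at (pos u) ≡ u
    at-pos pos≤m = nth-position x P (s≤s pos≤m)

    pos≤m : ∀ {u} → u ∈ P → pos u ≤ m
    pos≤m u∈P = ≤-pred (position<length u∈P)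

    at-injective : ∀ {i j} → i ≤ m → j ≤ m → at i ≡ at j → i ≡ j
    at-injective {i} {j} i≤m j≤m at-i≡at-j = begin
      i          ≡⟨ pos-at i≤m ⟨
      pos (at i) ≡⟨ cong pos at-i≡at-j ⟩
      pos (at j) ≡⟨ pos-at j≤m ⟩
      j          ∎
      where open ≡-Reasoning

    at-∈C : ∀ {i} → 0 < i → i ≤ m → at i Sub.∈ C
    at-∈C {suc i} _ i≤m =
      T⇒∈C (nth-All x P⊆T (s≤s i≤m)) λ at-i≡x → 1+n≢0 (at-injective i≤m z≤n at-i≡x)

    prefix-walk : ∀ i → i ≤ m → WalkLen G Full x (at i) i
    prefix-walk zero _ = here tt
    prefix-walk (suc i) i<m = step (prefix-walk i (<⇒≤ i<m)) tt (at-adj i<m)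

    PathNeighbours : ℕ → Set
    PathNeighbours i = ∀ {u} → T u → Adj G (at i) u → u ≡ at (suc i) ⊎ ∃[ j ] i ≡ suc j × u ≡ at j

    pos-neighbour : ∀ {i u} → i < m → PathNeighbours i → T u → Adj G (at i) u → pos u ≤ suc i
    pos-neighbour i<m neighbours tu adj with neighbours tu adj
    ... | inj₁ refl = ≤-reflexive (pos-at i<m)
    ... | inj₂ (j , refl , refl) =
      ≤-trans (≤-reflexive (pos-at (≤-trans (n≤1+n j) (<⇒≤ i<m)))) (m≤n⇒m≤1+n (n≤1+n j))

    potential : ℕ → Fin n → ℕ
    potential i u with T? u
    ... | yes _ = pos u ⊓ suc i
    ... | no _ = 0

    pos-x : pos x ≡ 0
    pos-x = pos-at z≤n

    potential-x : ∀ i → potential i x ≡ 0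
    potential-x i with T? x
    ... | yes _ = cong (_⊓ suc i) pos-x
    ... | no _ = refl

    potential-v : ∀ {i} → i < m → potential i v ≡ suc i
    potential-v {i} i<m with T? v
    ... | yes _ = m≥n⇒m⊓n≡n (subst (suc i ≤_) (sym pos-v) i<m)
      where pos-v = trans (cong pos (sym at-last)) (pos-at ≤-refl)
    ... | no ¬tv = ⊥-elim (¬tv (inj₁ v∈C))

    -- The first i vertices of P have no other neighbours in T, and T is entered from outside only at x.
    potential-lipschitz : ∀ {i} → i < m → (∀ {j} → j < i → PathNeighbours j) →
      ∀ {u w} → Adj G u w → potential i w ≤ suc (potential i u)
    potential-lipschitz {i} i<m earlier {u} {w} adj with T? w | T? u
    ... | no _ | _ = z≤n
    ... | yes tw | yes _ = capped tw
      where
      capped : T w → pos w ⊓ suc i ≤ suc (pos u ⊓ suc i)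
      capped tw with suc (pos u) ≤? i
      ... | yes pos<i = begin
        pos w ⊓ suc i        ≤⟨ m⊓n≤m (pos w) (suc i) ⟩
        pos w                ≤⟨ pos-neighbour pos<m (earlier pos<i) tw adj′ ⟩
        suc (pos u)          ≡⟨ cong suc (m≤n⇒m⊓n≡m (m≤n⇒m≤1+n (<⇒≤ pos<i))) ⟨
        suc (pos u ⊓ suc i)  ∎
        where
        open ≤-Reasoning
        pos<m = <-trans pos<i i<m
        adj′ = subst (λ z → Adj G z w) (sym (at-pos (<⇒≤ pos<m))) adj
      ... | no pos≮i = ≤-trans (m⊓n≤n (pos w) (suc i)) (s≤s (⊓-glb (≮⇒≥ pos≮i) (n≤1+n i)))
    ... | yes (inj₁ w∈C) | no ¬tu = ⊥-elim (¬tu (C-neighbour-∈T w∈C (Adj-sym adj)))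
    ... | yes (inj₂ refl) | no _ = ≤-trans (m⊓n≤m (pos x) (suc i)) (≤-trans (≤-reflexive pos-x) z≤n)

    reaching-v-takes-longer : ∀ {i} → i < m → (∀ {j} → j < i → PathNeighbours j) →
      ∀ {d} → WalkLen G Full x v d → suc i ≤ d
    reaching-v-takes-longer {i} i<m earlier {d} W = begin
      suc i                      ≡⟨ potential-v i<m ⟨
      potential i v              ≤⟨ WalkLen-potential (potential i) (potential-lipschitz i<m earlier) W ⟩
      potential i x + d          ≡⟨ cong (_+ d) (potential-x i) ⟩
      d                          ∎
      where open ≤-Reasoning

    no-branching-before-v : ∀ {i} → 0 < i → i < m → (∀ {j} → j < i → PathNeighbours j) →
      ¬ 3 ≤ deg G (at i)
    no-branching-before-v {i} 0<i i<m earlier 3≤deg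
      with dᵢ , distᵢ ← distance (prefix-walk i (<⇒≤ i<m))
      with dᵥ , distᵥ ← distance (subst (λ z → WalkLen G Full x z m) at-last (prefix-walk m ≤-refl)) =
      1+n≰n (begin
        suc i  ≤⟨ reaching-v-takes-longer i<m earlier (proj₁ distᵥ) ⟩
        dᵥ     ≤⟨ v-nearest (at i) (at-∈C 0<i (<⇒≤ i<m)) 3≤deg dᵢ dᵥ distᵢ distᵥ ⟩
        dᵢ     ≤⟨ proj₂ distᵢ i (prefix-walk i (<⇒≤ i<m)) ⟩
        i      ∎)
      where open ≤-Reasoning

    no-second-C-neighbour-of-x : 0 < m → ∀ {u} → u Sub.∈ C → Adj G x u → u ≢ at 1 → ⊥
    no-second-C-neighbour-of-x 0<m {u} u∈C xu u≢at1
      with WalkLen⇒IsPath (proj₂ (C-connected u (at 1) u∈C (at-∈C (s≤s z≤n) 0<m)))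
    ... | _ ∷ [] , c≡at1 , c≡u , _ = u≢at1 (trans (sym c≡u) c≡at1)
    ... | c ∷ d ∷ l , c≡at1 , last≡u , unique , ⊆C , chain =
      proj₂ T-forest x (c ∷ d ∷ l)
        ( s≤s (s≤s z≤n)
        , All.map (λ y∈C x≡y → x∉C (subst (Sub._∈ C) (sym x≡y) y∈C)) ⊆C ∷ unique
        , inj₂ refl ∷ All.map inj₁ ⊆C
        , (subst (Adj G x) (sym c≡at1) (at-adj 0<m) , chain)
        , subst (λ z → Adj G z x) (sym last≡u) (Adj-sym xu))

    path-neighbours : ∀ {i} → i < m → PathNeighbours i
    path-neighbours {i} = <-rec (λ i → i < m → PathNeighbours i)
      (λ i earlier i<m → neighbours i<m (λ j<i → earlier j<i (<-trans j<i i<m))) i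
      where
      neighbours : ∀ {i} → i < m → (∀ {j} → j < i → PathNeighbours j) → PathNeighbours i
      neighbours {i} i<m earlier {u} tu adj with u ≟ᶠ at (suc i)
      ... | yes u≡next = inj₁ u≡next
      neighbours {zero} i<m earlier {u} tu adj | no u≢next =
        ⊥-elim (no-second-C-neighbour-of-x i<m (T⇒∈C tu (≢-sym (Adj⇒≢ adj))) adj u≢next)
      neighbours {suc j} i<m earlier {u} tu adj | no u≢next with u ≟ᶠ at j
      ... | yes u≡prev = inj₂ (j , refl , u≡prev)
      ... | no u≢prev = ⊥-elim (no-branching-before-v (s≤s z≤n) i<m earlier
            (three-neighbours⇒3≤deg prev≢next (≢-sym u≢prev) (≢-sym u≢next) (Adj-sym (at-adj j<m)) (at-adj i<m) adj))
        where
        j<m = <-trans (n<1+n j) i<m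
        prev≢next : at j ≢ at (suc (suc j))
        prev≢next at-j≡ = <⇒≢ (m≤n⇒m≤1+n (n<1+n j)) (at-injective (<⇒≤ j<m) i<m at-j≡)

    C-neighbour-on-path : ∀ {u w} → u Sub.∈ C → w ∈ P → w ≢ v → Adj G u w → u ∈ P
    C-neighbour-on-path {u} {w} u∈C w∈P w≢v adj with m≤n⇒m<n∨m≡n (pos≤m w∈P)
    ... | inj₂ pos≡m = ⊥-elim (w≢v (trans (sym (at-pos (pos≤m w∈P))) (trans (cong at pos≡m) at-last)))
    ... | inj₁ pos<m
      with path-neighbours pos<m (inj₁ u∈C) (subst (λ z → Adj G z u) (sym (at-pos (pos≤m w∈P))) (Adj-sym adj))
    ...   | inj₁ u≡next = subst (_∈ P) (sym u≡next) (at-∈ pos<m)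
    ...   | inj₂ (j , pos≡1+j , u≡prev) =
      subst (_∈ P) (sym u≡prev) (at-∈ (≤-trans (n≤1+n j) (subst (_≤ m) pos≡1+j (pos≤m w∈P))))

    module Reduction (a b : Fin n) (a≢b : a ≢ b) (a∈C : a Sub.∈ C) (b∈C : b Sub.∈ C)
      (va : Adj G v a) (vb : Adj G v b) (a∉P : ¬ a ∈ P) (b∉P : ¬ b ∈ P)
      (D : Subset n) (D-spec : ∀ u → u Sub.∈ D ⇔ (u ∈ P ⊎ u ≡ a ⊎ u ≡ b)) where

      OffPath : VSet n
      OffPath u = u Sub.∈ C × ¬ u ∈ P

      OffPath? : Decidable OffPath
      OffPath? u = (u ∈? C) ×-dec ¬? (Any.any? (u ≟ᶠ_) P)

      Removed : VSet n
      Removed u = u Sub.∈ C × u Sub.∉ D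

      Removed? : Decidable Removed
      Removed? u = (u ∈? C) ×-dec ¬? (u ∈? D)

      Kept : VSet n
      Kept u = ¬ Removed u

      D⊆Kept : ∀ {u} → u Sub.∈ D → Kept u
      D⊆Kept u∈D (_ , u∉D) = u∉D u∈D

      kept-v : Kept v
      kept-v = D⊆Kept (Equivalence.from (D-spec v) (inj₁ (subst (_∈ P) at-last (at-∈ ≤-refl))))

      kept-a : Kept a
      kept-a = D⊆Kept (Equivalence.from (D-spec a) (inj₂ (inj₁ refl)))

      kept-b : Kept b
      kept-b = D⊆Kept (Equivalence.from (D-spec b) (inj₂ (inj₂ refl)))

      Removed⇒OffPath : ∀ {u} → Removed u → OffPath u
      Removed⇒OffPath {u} (u∈C , u∉D) = u∈C , λ u∈P → u∉D (Equivalence.from (D-spec u) (inj₁ u∈P))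

      kept-off-path⇒a⊎b : ∀ {u} → OffPath u → Kept u → u ≡ a ⊎ u ≡ b
      kept-off-path⇒a⊎b {u} (u∈C , u∉P) kept with u ∈? D
      ... | no u∉D = ⊥-elim (kept (u∈C , u∉D))
      ... | yes u∈D with Equivalence.to (D-spec u) u∈D
      ...   | inj₁ u∈P = ⊥-elim (u∉P u∈P)
      ...   | inj₂ u≡a⊎b = u≡a⊎b

      OffPath-closed : ∀ {u w} → OffPath u → Adj G u w → OffPath w ⊎ w ≡ v
      OffPath-closed {u} {w} (u∈C , u∉P) adj with Any.any? (w ≟ᶠ_) P
      ... | yes w∈P with w ≟ᶠ v
      ...   | yes w≡v = inj₂ w≡v
      ...   | no w≢v = ⊥-elim (u∉P (C-neighbour-on-path u∈C w∈P w≢v adj))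
      OffPath-closed (u∈C , _) adj | no w∉P with C-neighbour-∈T u∈C adj
      ... | inj₁ w∈C = inj₁ (w∈C , w∉P)
      ... | inj₂ refl = ⊥-elim (w∉P (here refl))

      a-b-nonadjacent : ¬ Adj G a b
      a-b-nonadjacent ab = proj₂ T-forest v (a ∷ b ∷ [])
        ( s≤s (s≤s z≤n)
        , (Adj⇒≢ va ∷ Adj⇒≢ vb ∷ []) ∷ (a≢b ∷ []) ∷ [] ∷ []
        , inj₁ v∈C ∷ inj₁ a∈C ∷ inj₁ b∈C ∷ []
        , (va , ab , tt)
        , Adj-sym vb)

      module Lift (X′ : Subset n) (deletion : IsDeletionSet Kept X′) where

        deleting-v : ∀ X → v Sub.∈ X → (∀ {u} → u Sub.∉ X → ¬ OffPath u → u Sub.∉ X′) →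
          IsDeletionSet Full X
        deleting-v X v∈X covered =
          IsDeletionSet-glue OffPath OffPath? T-forest (λ off → inj₁ (proj₁ off)) closed rest deletion
          where
          closed : ∀ {u w} → u Sub.∉ X → w Sub.∉ X → Adj G u w → OffPath u → OffPath w
          closed _ w∉X adj off with OffPath-closed off adj
          ... | inj₁ off-w = off-w
          ... | inj₂ refl = ⊥-elim (w∉X v∈X)
          rest : ∀ {u} → u Sub.∉ X → ¬ OffPath u → (Kept ∖ X′) u
          rest u∉X ¬off = (λ removed → ¬off (Removed⇒OffPath removed)) , covered u∉X ¬off

        exchange-for-v : ∀ {e} → OffPath e → IsDeletionSet Full ((X′ Sub.- e) Sub.∪ Sub.⁅ v ⁆)
        exchange-for-v {e} off-e = deleting-v _ (x∈p∪q⁺ (inj₂ (x∈⁅x⁆ v))) λ u∉X ¬off u∈X′ →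
          u∉X (x∈p∪q⁺ (inj₁ (x∈p∧x≢y⇒x∈p-y u∈X′ λ u≡e → ¬off (subst OffPath (sym u≡e) off-e))))

        v-hangs-off-path : (∀ {w} → Adj G v w → w Sub.∉ X′ → OffPath w) → IsDeletionSet Full X′
        v-hangs-off-path v-neighbours = IsDeletionSet-glue Z Z? T-forest Z⊆T closed rest deletion
          where
          Z : VSet n
          Z u = OffPath u ⊎ u ≡ v
          Z? : Decidable Z
          Z? u = OffPath? u ⊎-dec (u ≟ᶠ v)
          Z⊆T : Z ⊆ T
          Z⊆T (inj₁ (u∈C , _)) = inj₁ u∈C
          Z⊆T (inj₂ refl) = inj₁ v∈C
          closed : ∀ {u w} → u Sub.∉ X′ → w Sub.∉ X′ → Adj G u w → Z u → Z w
          closed _ _ adj (inj₁ off) = OffPath-closed off adj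
          closed _ w∉X′ adj (inj₂ refl) = inj₁ (v-neighbours adj w∉X′)
          rest : ∀ {u} → u Sub.∉ X′ → ¬ Z u → (Kept ∖ X′) u
          rest u∉X′ ¬z = (λ removed → ¬z (inj₁ (Removed⇒OffPath removed))) , u∉X′

        Full∖X′-simple : Simple G (Full ∖ X′)
        Full∖X′-simple = Simple-cover (proj₁ T-forest) (proj₁ deletion) cover
          where
          cover : ∀ {u w} → (Full ∖ X′) u → (Full ∖ X′) w → Adj G u w →
            (T u × T w) ⊎ ((Kept ∖ X′) u × (Kept ∖ X′) w)
          cover {u} {w} (_ , u∉X′) (_ , w∉X′) adj with u ∈? C | w ∈? C
          ... | yes u∈C | _ = inj₁ (inj₁ u∈C , C-neighbour-∈T u∈C adj)
          ... | no _ | yes w∈C = inj₁ (C-neighbour-∈T w∈C (Adj-sym adj) , inj₁ w∈C)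
          ... | no u∉C | no w∉C = inj₂ ((u∉C ∘ proj₁ , u∉X′) , (w∉C ∘ proj₁ , w∉X′))

        collapse : Fin n → Fin n
        collapse u with Removed? u
        ... | yes _ = v
        ... | no _ = u

        collapse-removed : ∀ {u} → Removed u → collapse u ≡ v
        collapse-removed {u} removed with Removed? u
        ... | yes _ = refl
        ... | no kept = ⊥-elim (kept removed)

        collapse-kept : ∀ {u} → Kept u → collapse u ≡ u
        collapse-kept {u} kept with Removed? u
        ... | yes removed = ⊥-elim (kept removed)
        ... | no _ = refl

        removed-kept-edge : ∀ {u w} → Removed u → Kept w → Adj G u w → v ≡ w ⊎ Adj G v w
        removed-kept-edge removed kept adj with OffPath-closed (Removed⇒OffPath removed) adj
        ... | inj₂ w≡v = inj₁ (sym w≡v)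
        ... | inj₁ off with kept-off-path⇒a⊎b off kept
        ...   | inj₁ refl = inj₂ va
        ...   | inj₂ refl = inj₂ vb

        collapse-edge : ∀ {u w} → Adj G u w → collapse u ≡ collapse w ⊎ Adj G (collapse u) (collapse w)
        collapse-edge {u} {w} adj with Removed? u | Removed? w
        ... | yes _ | yes _ = inj₁ refl
        ... | no _ | no _ = inj₂ adj
        ... | yes ru | no kw = removed-kept-edge ru kw adj
        ... | no ku | yes rw with removed-kept-edge rw ku (Adj-sym adj)
        ...   | inj₁ v≡u = inj₁ (sym v≡u)
        ...   | inj₂ vu = inj₂ (Adj-sym vu)

        collapse-into : v Sub.∉ X′ → ∀ {u} → (Full ∖ X′) u → (Kept ∖ X′) (collapse u)
        collapse-into v∉X′ {u} (_ , u∉X′) with Removed? u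
        ... | yes _ = kept-v , v∉X′
        ... | no kept = kept , u∉X′

        collapse-Comp : v Sub.∉ X′ → ∀ {w u} → Comp G (Full ∖ X′) w u → Comp G (Kept ∖ X′) (collapse w) (collapse u)
        collapse-Comp v∉X′ = Comp-map collapse (collapse-into v∉X′) (λ _ _ → collapse-edge)

        v-component-not-PIG : a Sub.∉ X′ → b Sub.∉ X′ → ∀ {w₀} → Adj G v w₀ → ¬ OffPath w₀ → w₀ Sub.∉ X′ →
          ∀ {y} → Comp G (Kept ∖ X′) y v → ¬ IsPIG G (Comp G (Kept ∖ X′) y)
        v-component-not-PIG a∉X′ b∉X′ {w₀} vw₀ ¬off-w₀ w₀∉X′ kv pig =
          IsPIG-claw-free pig kv (Comp-step kv (kept-a , a∉X′) va) (Comp-step kv (kept-b , b∉X′) vb)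
            (Comp-step kv (¬off-w₀ ∘ Removed⇒OffPath , w₀∉X′) vw₀)
            ((va , vb , vw₀) , (a≢b , a-b-nonadjacent) , (off-path⇒≢w₀ (a∈C , a∉P) , off-path⇒¬adj-w₀ (a∈C , a∉P)) ,
             (off-path⇒≢w₀ (b∈C , b∉P) , off-path⇒¬adj-w₀ (b∈C , b∉P)))
          where
          off-path⇒≢w₀ : ∀ {c} → OffPath c → c ≢ w₀
          off-path⇒≢w₀ off-c refl = ¬off-w₀ off-c
          off-path⇒¬adj-w₀ : ∀ {c} → OffPath c → ¬ Adj G c w₀
          off-path⇒¬adj-w₀ off-c cw₀ with OffPath-closed off-c cw₀
          ... | inj₁ off-w₀ = ¬off-w₀ off-w₀
          ... | inj₂ w₀≡v = Adj⇒≢ vw₀ (sym w₀≡v)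

        v-centres-claw : v Sub.∉ X′ → a Sub.∉ X′ → b Sub.∉ X′ →
          ∀ {w₀} → Adj G v w₀ → ¬ OffPath w₀ → w₀ Sub.∉ X′ → IsDeletionSet Full X′
        v-centres-claw v∉X′ a∉X′ b∉X′ vw₀ ¬off-w₀ w₀∉X′ = Full∖X′-simple , components
          where
          collapsed : ∀ {w u} → Comp G (Full ∖ X′) w u → Kept u → Comp G (Kept ∖ X′) (collapse w) u
          collapsed r kept = subst (Comp G _ _) (collapse-kept kept) (collapse-Comp v∉X′ r)
          components : ∀ w → Full w → w Sub.∉ X′ → IsPIGorTree (Comp G (Full ∖ X′) w)
          components w _ w∉X′ with collapse-into v∉X′ (tt , w∉X′)
          ... | kept-w′ , w′∉X′ with proj₂ deletion (collapse w) kept-w′ w′∉X′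
          ... | inj₁ pig = inj₁ (IsPIG-⊆ into-kept pig)
            where
            into-kept : Comp G (Full ∖ X′) w ⊆ Comp G (Kept ∖ X′) (collapse w)
            into-kept {u} r with Removed? u
            ... | no kept = collapsed r kept
            ... | yes removed = ⊥-elim (v-component-not-PIG a∉X′ b∉X′ vw₀ ¬off-w₀ w₀∉X′
                    (subst (Comp G _ _) (collapse-removed removed) (collapse-Comp v∉X′ r)) pig)
          ... | inj₂ (_ , _ , acyclic) =
            inj₂ (Comp-connected , (λ u u′ ku ku′ → Full∖X′-simple u u′ (Comp-⊆ ku) (Comp-⊆ ku′)) , no-cycle)
            where
            no-cycle : ∀ c l → ¬ IsCycle G (Comp G (Full ∖ X′) w) c l
            no-cycle c l cycle@(_ , _ , inComp , _) with cycle-inside-or-outside cycle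
            ... | inj₁ inT = proj₂ T-forest c l (IsCycle-on inT cycle)
            ... | inj₂ offC = acyclic c l
                    (IsCycle-on (All.zipWith (λ (r , u∉C) → collapsed r (u∉C ∘ proj₁)) (inComp , offC)) cycle)

        solution : ∀ {k} → ∣ X′ ∣ ≤ k → PITVD G Full k
        solution size with v ∈? X′ | a ∈? X′ | b ∈? X′
        ... | yes v∈X′ | _ | _ = X′ , (λ _ _ → tt) , size , deleting-v X′ v∈X′ (λ u∉X′ _ → u∉X′)
        ... | no _ | yes a∈X′ | _ =
          _ , (λ _ _ → tt) , ≤-trans (∣p-x∪⁅y⁆∣≤∣p∣ v a∈X′) size , exchange-for-v (a∈C , a∉P)
        ... | no _ | no _ | yes b∈X′ =
          _ , (λ _ _ → tt) , ≤-trans (∣p-x∪⁅y⁆∣≤∣p∣ v b∈X′) size , exchange-for-v (b∈C , b∉P)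
        ... | no v∉X′ | no a∉X′ | no b∉X′ with any? (λ w → Adj? v w ×-dec ¬? (OffPath? w) ×-dec ¬? (w ∈? X′))
        ...   | yes (w₀ , vw₀ , ¬off , w₀∉X′) =
          X′ , (λ _ _ → tt) , size , v-centres-claw v∉X′ a∉X′ b∉X′ vw₀ ¬off w₀∉X′
        ...   | no none = X′ , (λ _ _ → tt) , size , v-hangs-off-path λ {w} vw w∉X′ →
          decidable-stable (OffPath? w) λ ¬off → none (w , vw , ¬off , w∉X′)

      reduction-safe : ∀ {k} → PITVD G Full k ⇔ PITVD G Kept k
      reduction-safe = mk⇔ (PITVD-complement (C Sub.∩ Sub.∁ D) kept⇒∉ ∉⇒kept)
        λ (X′ , _ , size , deletion) → Lift.solution X′ deletion size
        where
        kept⇒∉ : ∀ {u} → Kept u → u Sub.∉ C Sub.∩ Sub.∁ D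
        kept⇒∉ kept u∈ = let (u∈C , u∈∁D) = x∈p∩q⁻ C (Sub.∁ D) u∈ in kept (u∈C , x∈∁p⇒x∉p u∈∁D)
        ∉⇒kept : ∀ {u} → u Sub.∉ C Sub.∩ Sub.∁ D → Kept u
        ∉⇒kept u∉ (u∈C , u∉D) = u∉ (x∈p∩q⁺ (u∈C , x∉p⇒x∈∁p u∉D))

lemma7 : ∀ {n} (G : MGraph n) (k : ℕ) (x : Fin n) (C : Subset n) →
    CutVertex G x →
    PendantTree G x C →
    (v : Fin n) → v Sub.∈ C → 3 ≤ deg G v →
    (∀ u → u Sub.∈ C → 3 ≤ deg G u → ∀ du dv →
      IsDist G Full x u du → IsDist G Full x v dv → dv ≤ du) →
    (P : List (Fin n)) → IsPath G (λ u → u Sub.∈ C ⊎ u ≡ x) x v P →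
    (a b : Fin n) → a ≢ b → a Sub.∈ C → b Sub.∈ C →
    Adj G v a → Adj G v b → ¬ (a L.∈ P) → ¬ (b L.∈ P) →
    (D : Subset n) → (∀ u → u Sub.∈ D ⇔ (u L.∈ P ⊎ u ≡ a ⊎ u ≡ b)) →
    PITVD G Full k ⇔ PITVD G (λ u → ¬ (u Sub.∈ C × u Sub.∉ D)) k
lemma7 G k x C _ pendant v v∈C _ v-nearest (_ ∷ ps) (refl , last≡v , P-unique , P⊆T , P-chain)
  a b a≢b a∈C b∈C va vb a∉P b∉P D D-spec =
  Reduction.reduction-safe a b a≢b a∈C b∈C va vb a∉P b∉P D D-spec
  where open Pendant.BranchPath G x C pendant v v∈C v-nearest ps last≡v P-unique P⊆T P-chain
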